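{- Let $G$ be a connected graph with chromatic number $\chi(G)=k$ and independence number $\alpha(G)=2$. If $G$ has a cut-set $S$ with $|S|\leq 2$ such that $S$ is a clique, then the clique number of $G$ satisfies $\omega(G)=k$.
   Context: All graphs are finite and simple. A cut-set of a connected graph $G$ is a set $S\subseteq V(G)$ such that $G\setminus S$ is disconnected. $\alpha(G)$ is the maximum size of a set of pairwise nonadjacent vertices; $\omega(G)$ is the maximum size of a clique. -}

module Defs where

open import Data.Nat using (ℕ; _≤_)
open import Data.Fin using (Fin)
open import Data.Fin.Subset using (Subset; _∈_; _∉_; ∣_∣)
open import Data.Product using (Σ; _×_; _,_)
open import Relation.Nullary using (¬_; Dec)
open import Relation.Binary.PropositionalEquality using (_≡_; _≢_)

record Graph (n : ℕ) : Set₁ where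
  field
    Adj   : Fin n → Fin n → Set
    dec   : ∀ u v → Dec (Adj u v)
    sym   : ∀ {u v} → Adj u v → Adj v u
    irrefl : ∀ {u} → ¬ Adj u u
open Graph public

module _ {n : ℕ} (G : Graph n) where

  data WalkAvoiding (S : Subset n) : Fin n → Fin n → Set where
    here : ∀ {u} → u ∉ S → WalkAvoiding S u u
    step : ∀ {u w v} → u ∉ S → Adj G u w → WalkAvoiding S w v → WalkAvoiding S u v

  data Walk : Fin n → Fin n → Set where
    here : ∀ {u} → Walk u u
    step : ∀ {u w v} → Adj G u w → Walk w v → Walk u v

  Connected : Set
  Connected = ∀ u v → Walk u v

  IsCutSet : Subset n → Set
  IsCutSet S = Σ (Fin n) λ u → Σ (Fin n) λ v →
    u ∉ S × v ∉ S × ¬ WalkAvoiding S u v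

  IsClique : Subset n → Set
  IsClique S = ∀ {u v} → u ∈ S → v ∈ S → u ≢ v → Adj G u v

  IsIndependent : Subset n → Set
  IsIndependent S = ∀ {u v} → u ∈ S → v ∈ S → ¬ Adj G u v

  ProperColouring : ℕ → Set
  ProperColouring k = Σ (Fin n → Fin k) λ c → ∀ {u v} → Adj G u v → c u ≢ c v

  ChromaticNumber : ℕ → Set
  ChromaticNumber k = ProperColouring k × (∀ m → ProperColouring m → k ≤ m)

  IndependenceNumber : ℕ → Set
  IndependenceNumber a =
    (Σ (Subset n) λ I → IsIndependent I × ∣ I ∣ ≡ a) ×
    (∀ I → IsIndependent I → ∣ I ∣ ≤ a)

  CliqueNumber : ℕ → Set
  CliqueNumber w =
    (Σ (Subset n) λ K → IsClique K × ∣ K ∣ ≡ w) ×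
    (∀ K → IsClique K → ∣ K ∣ ≤ w)

-- A clique needs as many colours as it has vertices, so ω ≤ χ; the work is a colouring
-- with ω(G) colours. Let S separate u from v, let A be u together with its neighbours
-- outside S, and B the remaining vertices outside S. As α(G) = 2, A and B are cliques (two
-- non-adjacent vertices of A would form an independent triple with v, two of B one with u),
-- and there are no edges between A and B. Each side A ∪ S and B ∪ S is thus a clique plus at
-- most two adjacent vertices, and can be coloured by the vertices of one of its own cliques:
-- an extra vertex joins the colour class of a non-neighbour or gets a colour of its own, and
-- when both extra vertices miss exactly the same vertex x, the two of them replace x in the
-- clique. Since S is a clique, the colours of the side with the smaller clique can be permuted
-- to agree with the other side on S, and the two colourings glue to one of G with ω(G) colours.
module Submission where

open import Defs
open import Data.Nat using (ℕ; zero; suc; _≤_)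
open import Data.Nat.Properties using (≤-antisym; ≤-total; <⇒≱)
open import Data.Fin using (Fin; zero; suc; _≟_; inject≤)
open import Data.Fin.Properties using (suc-injective; 0≢1+n; injective⇒≤; inject≤-injective; any?)
open import Data.Fin.Permutation using (Permutation′; _⟨$⟩ʳ_; _∘ₚ_; transpose) renaming (id to idₚ)
import Data.Fin.Permutation.Components as PC
open import Data.Fin.Subset
  using (Subset; _∈_; _∉_; _⊆_; _∪_; _∩_; _-_; ∁; ⁅_⁆; ∣_∣; inside; outside; Empty)
open import Data.Fin.Subset.Properties
  using (_∈?_; nonempty?; x∈⁅x⁆; x∈⁅y⁆⇒x≡y; x∈p∪q⁺; x∈p∪q⁻; x∈p∩q⁺; x∈p∩q⁻; p⊆p∪q; q⊆p∪q;
         x∈p∧x≢y⇒x∈p-y; p─q⊆p; ∪-assoc; ∪-idem; p∩q⊆p; p∩q⊆q; x∈∁p⇒x∉p; x∉p⇒x∈∁p; ∩-comm)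
open import Data.Vec using (_∷_; []; here; there; lookup)
open import Data.Vec.Functional using (updateAt)
open import Data.Vec.Functional.Properties using (updateAt-updates; updateAt-minimal; updateAt-id-local)
open import Data.Product using (Σ-syntax; _×_; _,_; proj₁; proj₂)
open import Data.Sum using (_⊎_; inj₁; inj₂; [_,_]′)
import Data.Sum as Sum
open import Function using (id; _∘_; const; Injection)
open import Function.Definitions using (Injective)
open import Function.Properties.Inverse using (↔⇒↣)
open import Relation.Nullary using (¬_; Dec; yes; no; contradiction)
open import Relation.Nullary.Decidable using (dec-true; dec-false; decidable-stable; _×-dec_; _⊎-dec_; ¬?)
open import Relation.Unary using (Decidable)
open import Relation.Binary.PropositionalEquality
  using (_≡_; _≢_; refl; cong; trans; subst; subst₂; module ≡-Reasoning) renaming (sym to ≡-sym)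

private variable
  n m d : ℕ
  x y z w s t : Fin n
  k : ℕ
  p q r P Q K X S : Subset n

select : (p : Subset n) → Fin ∣ p ∣ → Fin n
select (inside ∷ p) zero = zero
select (inside ∷ p) (suc i) = suc (select p i)
select (outside ∷ p) i = suc (select p i)

select-∈ : (p : Subset n) (i : Fin ∣ p ∣) → select p i ∈ p
select-∈ (inside ∷ p) zero = here
select-∈ (inside ∷ p) (suc i) = there (select-∈ p i)
select-∈ (outside ∷ p) i = there (select-∈ p i)

select-injective : (p : Subset n) → Injective _≡_ _≡_ (select p)
select-injective (inside ∷ p) {zero} {zero} eq = refl
select-injective (inside ∷ p) {suc i} {suc j} eq = cong suc (select-injective p (suc-injective eq))
select-injective (outside ∷ p) eq = select-injective p (suc-injective eq)

rank : x ∈ p → Fin ∣ p ∣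
rank {p = inside ∷ p} here = zero
rank {p = inside ∷ p} (there x∈p) = suc (rank x∈p)
rank {p = outside ∷ p} (there x∈p) = rank x∈p

select-rank : (x∈p : x ∈ p) → select p (rank x∈p) ≡ x
select-rank {p = inside ∷ p} here = refl
select-rank {p = inside ∷ p} (there x∈p) = cong suc (select-rank x∈p)
select-rank {p = outside ∷ p} (there x∈p) = cong suc (select-rank x∈p)

rank-injective : (x∈p : x ∈ p) (y∈p : y ∈ p) → rank x∈p ≡ rank y∈p → x ≡ y
rank-injective {p = p} x∈p y∈p eq =
  trans (≡-sym (select-rank x∈p)) (trans (cong (select p) eq) (select-rank y∈p))

injective⇒≤∣p∣ : {f : Fin d → Fin n} → (∀ i → f i ∈ p) → Injective _≡_ _≡_ f → d ≤ ∣ p ∣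
injective⇒≤∣p∣ f∈p f-injective = injective⇒≤ (f-injective ∘ rank-injective (f∈p _) (f∈p _))

distinct-triple⇒3≤∣p∣ : x ∈ p → y ∈ p → z ∈ p → x ≢ y → x ≢ z → y ≢ z → 3 ≤ ∣ p ∣
distinct-triple⇒3≤∣p∣ {x = x} {y = y} {z = z} x∈p y∈p z∈p x≢y x≢z y≢z =
  injective⇒≤∣p∣ {f = lookup (x ∷ y ∷ z ∷ [])} triple-∈ triple-injective
  where
  triple-∈ : ∀ i → lookup (x ∷ y ∷ z ∷ []) i ∈ _
  triple-∈ zero = x∈p
  triple-∈ (suc zero) = y∈p
  triple-∈ (suc (suc zero)) = z∈p
  triple-injective : Injective _≡_ _≡_ (lookup (x ∷ y ∷ z ∷ []))
  triple-injective {zero} {zero} _ = refl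
  triple-injective {zero} {suc zero} eq = contradiction eq x≢y
  triple-injective {zero} {suc (suc zero)} eq = contradiction eq x≢z
  triple-injective {suc zero} {zero} eq = contradiction (≡-sym eq) x≢y
  triple-injective {suc zero} {suc zero} _ = refl
  triple-injective {suc zero} {suc (suc zero)} eq = contradiction eq y≢z
  triple-injective {suc (suc zero)} {zero} eq = contradiction (≡-sym eq) x≢z
  triple-injective {suc (suc zero)} {suc zero} eq = contradiction (≡-sym eq) y≢z
  triple-injective {suc (suc zero)} {suc (suc zero)} _ = refl

∈∪⁅⁆⁻ : x ∈ p ∪ ⁅ s ⁆ → x ∈ p ⊎ x ≡ s
∈∪⁅⁆⁻ {p = p} {s = s} = Sum.map₂ (x∈⁅y⁆⇒x≡y s) ∘ x∈p∪q⁻ p ⁅ s ⁆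

∈∪⁅⁆⁺ : x ∈ p ⊎ x ≡ s → x ∈ p ∪ ⁅ s ⁆
∈∪⁅⁆⁺ (inj₁ x∈p) = x∈p∪q⁺ (inj₁ x∈p)
∈∪⁅⁆⁺ (inj₂ refl) = x∈p∪q⁺ (inj₂ (x∈⁅x⁆ _))

∈∪⁅⁆-other : x ∈ p ∪ ⁅ s ⁆ → x ≢ s → x ∈ p
∈∪⁅⁆-other x∈ x≢s = [ id , (λ x≡s → contradiction x≡s x≢s) ]′ (∈∪⁅⁆⁻ x∈)

∪-monoˡ : p ⊆ q → p ∪ r ⊆ q ∪ r
∪-monoˡ {p = p} {r = r} p⊆q = x∈p∪q⁺ ∘ Sum.map₁ p⊆q ∘ x∈p∪q⁻ p r

∪-monoʳ : p ⊆ q → r ∪ p ⊆ r ∪ q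
∪-monoʳ {p = p} {r = r} p⊆q = x∈p∪q⁺ ∘ Sum.map₂ p⊆q ∘ x∈p∪q⁻ r p

⁅s⁆∪⁅t⁆⊆p : s ∈ p → t ∈ p → ⁅ s ⁆ ∪ ⁅ t ⁆ ⊆ p
⁅s⁆∪⁅t⁆⊆p {s = s} {p = p} s∈p t∈p =
  [ (λ x∈⁅s⁆ → subst (_∈ p) (≡-sym (x∈⁅y⁆⇒x≡y s x∈⁅s⁆)) s∈p) , (λ { refl → t∈p }) ]′ ∘ ∈∪⁅⁆⁻

∪⁅⁆-swap : (p ∪ ⁅ s ⁆) ∪ ⁅ t ⁆ ⊆ (p ∪ ⁅ t ⁆) ∪ ⁅ s ⁆
∪⁅⁆-swap x∈ with ∈∪⁅⁆⁻ x∈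
... | inj₂ refl = ∈∪⁅⁆⁺ (inj₁ (∈∪⁅⁆⁺ (inj₂ refl)))
... | inj₁ x∈ with ∈∪⁅⁆⁻ x∈
...   | inj₁ x∈p = ∈∪⁅⁆⁺ (inj₁ (∈∪⁅⁆⁺ (inj₁ x∈p)))
...   | inj₂ refl = ∈∪⁅⁆⁺ (inj₂ refl)

p⊆p-x∪⁅x⁆ : p ⊆ (p - x) ∪ ⁅ x ⁆
p⊆p-x∪⁅x⁆ {x = x} {z} z∈p with z ≟ x
... | yes z≡x = ∈∪⁅⁆⁺ (inj₂ z≡x)
... | no z≢x = ∈∪⁅⁆⁺ (inj₁ (x∈p∧x≢y⇒x∈p-y z∈p z≢x))

x∈p-y⇒x≢y : x ∈ p - y → x ≢ y
x∈p-y⇒x≢y {x = zero} {p = _ ∷ _} {y = zero} () refl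
x∈p-y⇒x≢y {x = suc x} {p = _ ∷ _} {y = suc y} (there x∈p-y) refl = x∈p-y⇒x≢y x∈p-y refl

∣p∣≤2⇒⊆pair : ∣ p ∣ ≤ 2 → Empty p ⊎ Σ[ s ∈ Fin n ] Σ[ t ∈ Fin n ] s ∈ p × t ∈ p × p ⊆ ⁅ s ⁆ ∪ ⁅ t ⁆
∣p∣≤2⇒⊆pair {p = p} ∣p∣≤2 with nonempty? p
... | no empty = inj₁ empty
... | yes (s , s∈p) with any? (λ t → t ∈? p ×-dec ¬? (t ≟ s))
...   | no only-s = inj₂ (s , s , s∈p , s∈p , ∈∪⁅⁆⁺ ∘ inj₂ ∘ ≡s)
  where
  ≡s : x ∈ p → x ≡ s
  ≡s {x = x} x∈p with x ≟ s
  ... | yes x≡s = x≡s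
  ... | no x≢s = contradiction (x , x∈p , x≢s) only-s
...   | yes (t , t∈p , t≢s) = inj₂ (s , t , s∈p , t∈p , ⊆pair)
  where
  ⊆pair : p ⊆ ⁅ s ⁆ ∪ ⁅ t ⁆
  ⊆pair {x} x∈p with x ≟ s | x ≟ t
  ... | yes refl | _ = ∈∪⁅⁆⁺ (inj₁ (x∈⁅x⁆ x))
  ... | no _ | yes x≡t = ∈∪⁅⁆⁺ (inj₂ x≡t)
  ... | no x≢s | no x≢t =
    contradiction ∣p∣≤2 (<⇒≱ (distinct-triple⇒3≤∣p∣ x∈p s∈p t∈p x≢s x≢t (t≢s ∘ ≡-sym)))

fromDec : {P : Fin n → Set} → Decidable P → Subset n
fromDec {zero} P? = []
fromDec {suc n} P? with P? zero
... | yes _ = inside ∷ fromDec (P? ∘ suc)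
... | no _ = outside ∷ fromDec (P? ∘ suc)

∈fromDec⁺ : {P : Fin n → Set} (P? : Decidable P) → P x → x ∈ fromDec P?
∈fromDec⁺ {x = zero} P? Px with P? zero
... | yes _ = here
... | no ¬P0 = contradiction Px ¬P0
∈fromDec⁺ {x = suc x} P? Px with P? zero
... | yes _ = there (∈fromDec⁺ (P? ∘ suc) Px)
... | no _ = there (∈fromDec⁺ (P? ∘ suc) Px)

∈fromDec⁻ : {P : Fin n → Set} (P? : Decidable P) → x ∈ fromDec P? → P x
∈fromDec⁻ {x = zero} P? x∈ with P? zero | x∈
... | yes P0 | _ = P0
... | no _ | ()
∈fromDec⁻ {x = suc x} P? x∈ with P? zero | x∈
... | yes _ | there x∈′ = ∈fromDec⁻ (P? ∘ suc) x∈′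
... | no _ | there x∈′ = ∈fromDec⁻ (P? ∘ suc) x∈′

transpose-here : (i j : Fin m) → PC.transpose i j i ≡ j
transpose-here i j rewrite dec-true (i ≟ i) refl = refl

transpose-elsewhere : {i j k : Fin m} → k ≢ i → k ≢ j → PC.transpose i j k ≡ k
transpose-elsewhere {i = i} {j} {k} k≢i k≢j rewrite dec-false (k ≟ i) k≢i | dec-false (k ≟ j) k≢j = refl

permutation-injective : (π : Permutation′ m) → Injective _≡_ _≡_ (π ⟨$⟩ʳ_)
permutation-injective π = Injection.injective (↔⇒↣ π)

extend-to-permutation : (a b : Fin d → Fin m) → Injective _≡_ _≡_ a → Injective _≡_ _≡_ b →
                        Σ[ π ∈ Permutation′ m ] (∀ i → π ⟨$⟩ʳ a i ≡ b i)
extend-to-permutation {zero} a b _ _ = idₚ , λ ()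
extend-to-permutation {suc d} a b a-injective b-injective = π ∘ₚ τ , extends
  where
  π₀ = extend-to-permutation (a ∘ suc) (b ∘ suc) (suc-injective ∘ a-injective) (suc-injective ∘ b-injective)
  π = proj₁ π₀
  τ = transpose (π ⟨$⟩ʳ a zero) (b zero)
  extends : ∀ i → τ ⟨$⟩ʳ (π ⟨$⟩ʳ a i) ≡ b i
  extends zero = transpose-here (π ⟨$⟩ʳ a zero) (b zero)
  extends (suc i) = begin
    τ ⟨$⟩ʳ (π ⟨$⟩ʳ a (suc i)) ≡⟨ cong (τ ⟨$⟩ʳ_) (proj₂ π₀ i) ⟩
    τ ⟨$⟩ʳ b (suc i)          ≡⟨ transpose-elsewhere
                                   (λ eq → 0≢1+n (≡-sym (a-injective (permutation-injective π (trans (proj₂ π₀ i) eq)))))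
                                   (λ eq → 0≢1+n (≡-sym (b-injective eq))) ⟩
    b (suc i)                 ∎
    where open ≡-Reasoning

module _ (G : Graph n) where

  adjacent⇒≢ : Adj G x y → x ≢ y
  adjacent⇒≢ x~y refl = irrefl G x~y

  ColouringOn : Subset n → ℕ → Set
  ColouringOn P m = Σ[ c ∈ (Fin n → Fin m) ] (∀ {x y} → x ∈ P → y ∈ P → Adj G x y → c x ≢ c y)

  ColouringOn-⊆ : Q ⊆ P → ColouringOn P m → ColouringOn Q m
  ColouringOn-⊆ Q⊆P (c , proper) = c , λ x∈Q y∈Q → proper (Q⊆P x∈Q) (Q⊆P y∈Q)

  ColouringOn-inject≤ : {m′ : ℕ} → m ≤ m′ → ColouringOn P m → ColouringOn P m′
  ColouringOn-inject≤ m≤m′ (c , proper) =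
    (λ x → inject≤ (c x) m≤m′) , λ x∈P y∈P x~y → proper x∈P y∈P x~y ∘ inject≤-injective m≤m′ m≤m′ _ _

  colouring-injective-on-clique : IsClique G K → (C : ColouringOn K m) → Injective _≡_ _≡_ (proj₁ C ∘ select K)
  colouring-injective-on-clique {K = K} K-clique (c , proper) {i} {j} eq with select K i ≟ select K j
  ... | yes same = select-injective K same
  ... | no differ = contradiction eq (proper xᵢ∈K xⱼ∈K (K-clique xᵢ∈K xⱼ∈K differ))
    where
    xᵢ∈K = select-∈ K i
    xⱼ∈K = select-∈ K j

  clique≤colours : IsClique G K → ProperColouring G m → ∣ K ∣ ≤ m
  clique≤colours K-clique (c , proper) = injective⇒≤ (colouring-injective-on-clique K-clique (c , λ _ _ → proper))

  cliqueNumber-of-colouring : ChromaticNumber G k → IsClique G K → ProperColouring G ∣ K ∣ → CliqueNumber G k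
  cliqueNumber-of-colouring {K = K} (χ-colouring , χ-minimal) K-clique K-colouring =
    (K , K-clique , ≤-antisym (clique≤colours K-clique χ-colouring) (χ-minimal _ K-colouring)) ,
    λ _ K′-clique → clique≤colours K′-clique χ-colouring

  -- The colours on Q are permuted so that the two colourings agree on the clique P ∩ Q.
  glue-colourings : (∀ x → x ∈ P ⊎ x ∈ Q) → (∀ {x y} → x ∈ P → y ∈ Q → Adj G x y → x ∈ Q ⊎ y ∈ P) →
                    IsClique G (P ∩ Q) → ColouringOn P m → ColouringOn Q m → ProperColouring G m
  glue-colourings {P = P} {Q = Q} {m = m} cover separated PQ-clique C₁@(c₁ , proper₁) C₂@(c₂ , proper₂) = colour , proper
    where
    π₀ = extend-to-permutation (c₂ ∘ select (P ∩ Q)) (c₁ ∘ select (P ∩ Q))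
           (colouring-injective-on-clique PQ-clique (ColouringOn-⊆ (p∩q⊆q P Q) C₂))
           (colouring-injective-on-clique PQ-clique (ColouringOn-⊆ (p∩q⊆p P Q) C₁))
    π = proj₁ π₀

    agree : x ∈ P → x ∈ Q → π ⟨$⟩ʳ c₂ x ≡ c₁ x
    agree x∈P x∈Q = subst (λ z → π ⟨$⟩ʳ c₂ z ≡ c₁ z) (select-rank x∈P∩Q) (proj₂ π₀ (rank x∈P∩Q))
      where x∈P∩Q = x∈p∩q⁺ (x∈P , x∈Q)

    ∈P : x ∉ Q → x ∈ P
    ∈P {x} x∉Q = [ id , (λ x∈Q → contradiction x∈Q x∉Q) ]′ (cover x)

    colour : Fin n → Fin m
    colour x with x ∈? Q
    ... | yes _ = π ⟨$⟩ʳ c₂ x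
    ... | no _ = c₁ x

    mixed : x ∈ Q → y ∉ Q → Adj G x y → π ⟨$⟩ʳ c₂ x ≢ c₁ y
    mixed x∈Q y∉Q x~y with separated (∈P y∉Q) x∈Q (sym G x~y)
    ... | inj₁ y∈Q = contradiction y∈Q y∉Q
    ... | inj₂ x∈P = proper₁ x∈P (∈P y∉Q) x~y ∘ trans (≡-sym (agree x∈P x∈Q))

    proper : Adj G x y → colour x ≢ colour y
    proper {x} {y} x~y with x ∈? Q | y ∈? Q
    ... | yes x∈Q | yes y∈Q = proper₂ x∈Q y∈Q x~y ∘ permutation-injective π
    ... | yes x∈Q | no y∉Q = mixed x∈Q y∉Q x~y
    ... | no x∉Q | yes y∈Q = mixed y∈Q x∉Q (sym G x~y) ∘ ≡-sym
    ... | no x∉Q | no y∉Q = proper₁ (∈P x∉Q) (∈P y∉Q) x~y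

  -- Witnesses χ(G[P]) ≤ ω(G[P]): the colours are the vertices of a clique inside P.
  record CliqueColouring (P : Subset n) : Set where
    field
      clique : Subset n
      clique⊆P : clique ⊆ P
      isClique : IsClique G clique
      colour : Fin n → Fin n
      colour∈clique : ∀ {x} → x ∈ P → colour x ∈ clique
      proper : ∀ {x y} → x ∈ P → y ∈ P → Adj G x y → colour x ≢ colour y

  open CliqueColouring

  -- x ∈ P supplies a colour for the vertices outside P, as Fin ∣ clique C ∣ might be empty.
  CliqueColouring⇒ColouringOn : (C : CliqueColouring P) → x ∈ P → ColouringOn P ∣ clique C ∣
  CliqueColouring⇒ColouringOn {P = P} C x₀∈P = c , proper′
    where
    c : Fin n → Fin ∣ clique C ∣
    c x with x ∈? P
    ... | yes x∈P = rank (colour∈clique C x∈P)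
    ... | no _ = rank (colour∈clique C x₀∈P)
    proper′ : x ∈ P → y ∈ P → Adj G x y → c x ≢ c y
    proper′ {x} {y} x∈P y∈P x~y with x ∈? P | y ∈? P
    ... | yes x∈P′ | yes y∈P′ = proper C x∈P′ y∈P′ x~y ∘ rank-injective (colour∈clique C x∈P′) (colour∈clique C y∈P′)
    ... | no x∉P | _ = contradiction x∈P x∉P
    ... | yes _ | no y∉P = contradiction y∈P y∉P

  identity-colouring : IsClique G K → CliqueColouring K
  identity-colouring {K = K} K-clique = record
    { clique = K
    ; clique⊆P = id
    ; isClique = K-clique
    ; colour = id
    ; colour∈clique = id
    ; proper = λ _ _ → adjacent⇒≢
    }

  cast : P ⊆ Q → Q ⊆ P → CliqueColouring P → CliqueColouring Q
  cast P⊆Q Q⊆P C = record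
    { clique = clique C
    ; clique⊆P = P⊆Q ∘ clique⊆P C
    ; isClique = isClique C
    ; colour = colour C
    ; colour∈clique = colour∈clique C ∘ Q⊆P
    ; proper = λ x∈Q y∈Q → proper C (Q⊆P x∈Q) (Q⊆P y∈Q)
    }

  recolour-∈ : (C : CliqueColouring P) → clique C ⊆ K → w ∈ K →
               ∀ {x} → x ∈ P ∪ ⁅ s ⁆ → updateAt (colour C) s (const w) x ∈ K
  recolour-∈ {K = K} {s = s} C K⊆ w∈K {x} x∈ with x ≟ s
  ... | yes refl = subst (_∈ K) (≡-sym (updateAt-updates s (colour C))) w∈K
  ... | no x≢s = subst (_∈ K) (≡-sym (updateAt-minimal x s (colour C) x≢s)) (K⊆ (colour∈clique C (∈∪⁅⁆-other x∈ x≢s)))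

  recolour-proper : (C : CliqueColouring P) → (∀ {y} → y ∈ P → Adj G s y → colour C y ≢ w) →
                    ∀ {x y} → x ∈ P ∪ ⁅ s ⁆ → y ∈ P ∪ ⁅ s ⁆ → Adj G x y →
                    updateAt (colour C) s (const w) x ≢ updateAt (colour C) s (const w) y
  recolour-proper {P = P} {s = s} {w = w} C s-free = proper′
    where
    colour′ = updateAt (colour C) s (const w)

    unchanged : z ≢ s → colour C z ≡ colour′ z
    unchanged {z} z≢s = ≡-sym (updateAt-minimal z s (colour C) z≢s)

    old≢new : z ∈ P ∪ ⁅ s ⁆ → z ≢ s → Adj G s z → colour′ z ≢ colour′ s
    old≢new z∈ z≢s s~z = subst₂ _≢_ (unchanged z≢s) (≡-sym (updateAt-updates s (colour C)))
                           (s-free (∈∪⁅⁆-other z∈ z≢s) s~z)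

    proper′ : x ∈ P ∪ ⁅ s ⁆ → y ∈ P ∪ ⁅ s ⁆ → Adj G x y → colour′ x ≢ colour′ y
    proper′ {x} {y} x∈ y∈ x~y with x ≟ s | y ≟ s
    ... | yes refl | yes refl = contradiction x~y (irrefl G)
    ... | yes refl | no y≢s = old≢new y∈ y≢s x~y ∘ ≡-sym
    ... | no x≢s | yes refl = old≢new x∈ x≢s (sym G x~y)
    ... | no x≢s | no y≢s =
      subst₂ _≢_ (unchanged x≢s) (unchanged y≢s) (proper C (∈∪⁅⁆-other x∈ x≢s) (∈∪⁅⁆-other y∈ y≢s) x~y)

  add-complete : (∀ {y} → y ∈ P → Adj G s y) → CliqueColouring P → CliqueColouring (P ∪ ⁅ s ⁆)
  add-complete {P = P} {s = s} s-complete C = record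
    { clique = clique C ∪ ⁅ s ⁆
    ; clique⊆P = ∪-monoˡ (clique⊆P C)
    ; isClique = isClique′
    ; colour = updateAt (colour C) s (const s)
    ; colour∈clique = recolour-∈ C (p⊆p∪q ⁅ s ⁆) (q⊆p∪q (clique C) ⁅ s ⁆ (x∈⁅x⁆ s))
    ; proper = recolour-proper C λ y∈P _ y↦s → s∉K (subst (_∈ clique C) y↦s (colour∈clique C y∈P))
    }
    where
    s∉K : s ∉ clique C
    s∉K s∈K = irrefl G (s-complete (clique⊆P C s∈K))

    isClique′ : IsClique G (clique C ∪ ⁅ s ⁆)
    isClique′ x∈ y∈ x≢y with ∈∪⁅⁆⁻ x∈ | ∈∪⁅⁆⁻ y∈
    ... | inj₁ x∈K | inj₁ y∈K = isClique C x∈K y∈K x≢y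
    ... | inj₁ x∈K | inj₂ refl = sym G (s-complete (clique⊆P C x∈K))
    ... | inj₂ refl | inj₁ y∈K = s-complete (clique⊆P C y∈K)
    ... | inj₂ refl | inj₂ refl = contradiction refl x≢y

  join-class : (C : CliqueColouring P) → w ∈ clique C → (∀ {y} → y ∈ P → Adj G s y → colour C y ≢ w) →
               CliqueColouring (P ∪ ⁅ s ⁆)
  join-class {w = w} {s = s} C w∈K s-free = record
    { clique = clique C
    ; clique⊆P = p⊆p∪q ⁅ s ⁆ ∘ clique⊆P C
    ; isClique = isClique C
    ; colour = updateAt (colour C) s (const w)
    ; colour∈clique = recolour-∈ C id w∈K
    ; proper = recolour-proper C s-free
    }

  nonNeighbour-or-complete : ∀ s X → (Σ[ x ∈ Fin n ] x ∈ X × ¬ Adj G s x) ⊎ (∀ {x} → x ∈ X → Adj G s x)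
  nonNeighbour-or-complete s X with any? (λ x → x ∈? X ×-dec ¬? (dec G s x))
  ... | yes nonNeighbour = inj₁ nonNeighbour
  ... | no none = inj₂ λ {x} x∈X → decidable-stable (dec G s x) (λ s≁x → none (x , x∈X , s≁x))

  clique∪⁅s⁆-colouring : IsClique G X → ∀ s → CliqueColouring (X ∪ ⁅ s ⁆)
  clique∪⁅s⁆-colouring {X = X} X-clique s with nonNeighbour-or-complete s X
  ... | inj₁ (x , x∈X , s≁x) = join-class (identity-colouring X-clique) x∈X (λ { _ s~y refl → s≁x s~y })
  ... | inj₂ s-complete = add-complete s-complete (identity-colouring X-clique)

  distinct-nonNeighbours : IsClique G X → x ∈ X → y ∈ X → x ≢ y → ¬ Adj G s x → ¬ Adj G t y →
                           CliqueColouring ((X ∪ ⁅ s ⁆) ∪ ⁅ t ⁆)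
  distinct-nonNeighbours {X = X} {x = x} {y = y} {s = s} {t = t} X-clique x∈X y∈X x≢y s≁x t≁y =
    join-class (join-class (identity-colouring X-clique) x∈X (λ { _ s~y refl → s≁x s~y })) y∈X t-avoids
    where
    t-avoids : z ∈ X ∪ ⁅ s ⁆ → Adj G t z → updateAt id s (const x) z ≢ y
    t-avoids {z} _ t~z z↦y with z ≟ s
    ... | yes refl = x≢y (trans (≡-sym (updateAt-updates s id)) z↦y)
    ... | no z≢s = t≁y (subst (Adj G t) (trans (≡-sym (updateAt-minimal z s id z≢s)) z↦y) t~z)

  -- x leaves the clique, s and t enter it, and x takes the colour s.
  shared-nonNeighbour : IsClique G X → x ∈ X → ¬ Adj G s x →
                        (∀ {y} → y ∈ X - x → Adj G s y) → (∀ {y} → y ∈ X - x → Adj G t y) → Adj G s t →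
                        CliqueColouring ((X ∪ ⁅ s ⁆) ∪ ⁅ t ⁆)
  shared-nonNeighbour {X = X} {x = x} {s = s} {t = t} X-clique x∈X s≁x s-complete t-complete s~t =
    cast built⊆ ⊆built (join-class C s∈K x-avoids)
    where
    C = add-complete t-adjacent (add-complete s-complete (identity-colouring X-x-clique))
      where
      X-x-clique : IsClique G (X - x)
      X-x-clique y∈ z∈ = X-clique (p─q⊆p X ⁅ x ⁆ y∈) (p─q⊆p X ⁅ x ⁆ z∈)
      t-adjacent : y ∈ (X - x) ∪ ⁅ s ⁆ → Adj G t y
      t-adjacent = [ t-complete , (λ { refl → sym G s~t }) ]′ ∘ ∈∪⁅⁆⁻
    s∈K : s ∈ ((X - x) ∪ ⁅ s ⁆) ∪ ⁅ t ⁆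
    s∈K = ∈∪⁅⁆⁺ (inj₁ (∈∪⁅⁆⁺ (inj₂ refl)))
    x-avoids : z ∈ ((X - x) ∪ ⁅ s ⁆) ∪ ⁅ t ⁆ → Adj G x z → colour C z ≢ s
    x-avoids {z} _ x~z z↦s with z ≟ t
    ... | yes refl = adjacent⇒≢ s~t (trans (≡-sym z↦s) (updateAt-updates z _))
    ... | no z≢t = s≁x (sym G (subst (Adj G x) z≡s x~z))
      where
      z≡s : z ≡ s
      z≡s = trans (≡-sym (trans (updateAt-minimal z t _ z≢t) (updateAt-id-local s id refl z))) z↦s
    built⊆ : (((X - x) ∪ ⁅ s ⁆) ∪ ⁅ t ⁆) ∪ ⁅ x ⁆ ⊆ (X ∪ ⁅ s ⁆) ∪ ⁅ t ⁆
    built⊆ = [ ∪-monoˡ (∪-monoˡ (p─q⊆p X ⁅ x ⁆)) , (λ { refl → p⊆p∪q ⁅ t ⁆ (p⊆p∪q ⁅ s ⁆ x∈X) }) ]′ ∘ ∈∪⁅⁆⁻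
    ⊆built : (X ∪ ⁅ s ⁆) ∪ ⁅ t ⁆ ⊆ (((X - x) ∪ ⁅ s ⁆) ∪ ⁅ t ⁆) ∪ ⁅ x ⁆
    ⊆built = ∪⁅⁆-swap ∘ ∪-monoˡ ∪⁅⁆-swap ∘ ∪-monoˡ (∪-monoˡ p⊆p-x∪⁅x⁆)

  clique∪⁅s,t⁆-colouring : IsClique G X → Adj G s t → CliqueColouring ((X ∪ ⁅ s ⁆) ∪ ⁅ t ⁆)
  clique∪⁅s,t⁆-colouring {X = X} {s = s} {t = t} X-clique s~t
    with nonNeighbour-or-complete s X | nonNeighbour-or-complete t X
  ... | _ | inj₂ t-complete =
    add-complete ([ t-complete , (λ { refl → sym G s~t }) ]′ ∘ ∈∪⁅⁆⁻) (clique∪⁅s⁆-colouring X-clique s)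
  ... | inj₂ s-complete | inj₁ _ =
    cast ∪⁅⁆-swap ∪⁅⁆-swap (add-complete ([ s-complete , (λ { refl → s~t }) ]′ ∘ ∈∪⁅⁆⁻) (clique∪⁅s⁆-colouring X-clique t))
  ... | inj₁ (x , x∈X , s≁x) | inj₁ (y , y∈X , t≁y) with x ≟ y
  ...   | no x≢y = distinct-nonNeighbours X-clique x∈X y∈X x≢y s≁x t≁y
  ...   | yes refl with nonNeighbour-or-complete s (X - x) | nonNeighbour-or-complete t (X - x)
  ...     | inj₁ (x′ , x′∈X-x , s≁x′) | _ =
    distinct-nonNeighbours X-clique (p─q⊆p X ⁅ x ⁆ x′∈X-x) x∈X (x∈p-y⇒x≢y x′∈X-x) s≁x′ t≁y
  ...     | inj₂ _ | inj₁ (y′ , y′∈X-x , t≁y′) =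
    distinct-nonNeighbours X-clique x∈X (p─q⊆p X ⁅ x ⁆ y′∈X-x) (x∈p-y⇒x≢y y′∈X-x ∘ ≡-sym) s≁x t≁y′
  ...     | inj₂ s-complete | inj₂ t-complete = shared-nonNeighbour X-clique x∈X s≁x s-complete t-complete s~t

  clique∪small-colouring : IsClique G X → IsClique G S → ∣ S ∣ ≤ 2 → CliqueColouring (X ∪ S)
  clique∪small-colouring {X = X} {S = S} X-clique S-clique ∣S∣≤2 with ∣p∣≤2⇒⊆pair ∣S∣≤2
  ... | inj₁ S-empty = cast (p⊆p∪q S) ([ id , (λ x∈S → contradiction (_ , x∈S) S-empty) ]′ ∘ x∈p∪q⁻ X S)
                         (identity-colouring X-clique)
  ... | inj₂ (s , t , s∈S , t∈S , S⊆st) =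
    cast (∪-monoʳ (⁅s⁆∪⁅t⁆⊆p s∈S t∈S)) (∪-monoʳ S⊆st) (pair-colouring (s ≟ t))
    where
    pair-colouring : Dec (s ≡ t) → CliqueColouring (X ∪ ⁅ s ⁆ ∪ ⁅ t ⁆)
    pair-colouring (yes refl) =
      subst CliqueColouring (cong (X ∪_) (≡-sym (∪-idem ⁅ s ⁆))) (clique∪⁅s⁆-colouring X-clique s)
    pair-colouring (no s≢t) =
      subst CliqueColouring (∪-assoc X ⁅ s ⁆ ⁅ t ⁆) (clique∪⁅s,t⁆-colouring X-clique (S-clique s∈S t∈S s≢t))

  clique-cutset-colouring : (∀ x → x ∈ P ⊎ x ∈ Q) → (∀ {x y} → x ∈ P → y ∈ Q → Adj G x y → x ∈ Q ⊎ y ∈ P) →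
                            IsClique G (P ∩ Q) → x ∈ P → y ∈ Q → CliqueColouring P → CliqueColouring Q →
                            Σ[ K ∈ Subset n ] IsClique G K × ProperColouring G ∣ K ∣
  clique-cutset-colouring {P = P} {Q = Q} cover separated PQ-clique x∈P y∈Q C₁ C₂
    with ≤-total ∣ clique C₂ ∣ ∣ clique C₁ ∣
  ... | inj₁ ∣K₂∣≤∣K₁∣ =
    clique C₁ , isClique C₁ ,
    glue-colourings cover separated PQ-clique
      (CliqueColouring⇒ColouringOn C₁ x∈P) (ColouringOn-inject≤ ∣K₂∣≤∣K₁∣ (CliqueColouring⇒ColouringOn C₂ y∈Q))
  ... | inj₂ ∣K₁∣≤∣K₂∣ =
    clique C₂ , isClique C₂ ,
    glue-colourings (Sum.swap ∘ cover) (λ y∈Q x∈P y~x → Sum.swap (separated x∈P y∈Q (sym G y~x)))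
      (subst (IsClique G) (∩-comm P Q) PQ-clique)
      (CliqueColouring⇒ColouringOn C₂ y∈Q) (ColouringOn-inject≤ ∣K₁∣≤∣K₂∣ (CliqueColouring⇒ColouringOn C₁ x∈P))

  common-nonNeighbour⇒adjacent : (∀ I → IsIndependent G I → ∣ I ∣ ≤ 2) →
                                 x ≢ y → z ≢ x → z ≢ y → ¬ Adj G x z → ¬ Adj G y z → Adj G x y
  common-nonNeighbour⇒adjacent {x = x} {y = y} {z = z} α≤2 x≢y z≢x z≢y x≁z y≁z =
    decidable-stable (dec G x y) λ x≁y →
      <⇒≱ (distinct-triple⇒3≤∣p∣ (∈I x (inj₁ refl)) (∈I y (inj₂ (inj₁ refl))) (∈I z (inj₂ (inj₂ refl)))
             x≢y (z≢x ∘ ≡-sym) (z≢y ∘ ≡-sym))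
          (α≤2 I λ a∈I b∈I → nonadjacent x≁y (∈fromDec⁻ I? a∈I) (∈fromDec⁻ I? b∈I))
    where
    I? = λ a → (a ≟ x) ⊎-dec (a ≟ y) ⊎-dec (a ≟ z)
    I = fromDec I?
    ∈I : ∀ a → a ≡ x ⊎ a ≡ y ⊎ a ≡ z → a ∈ I
    ∈I a = ∈fromDec⁺ I?
    nonadjacent : ¬ Adj G x y → {a b : Fin n} → a ≡ x ⊎ a ≡ y ⊎ a ≡ z → b ≡ x ⊎ b ≡ y ⊎ b ≡ z → ¬ Adj G a b
    nonadjacent x≁y (inj₁ refl) (inj₁ refl) = irrefl G
    nonadjacent x≁y (inj₁ refl) (inj₂ (inj₁ refl)) = x≁y
    nonadjacent x≁y (inj₁ refl) (inj₂ (inj₂ refl)) = x≁z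
    nonadjacent x≁y (inj₂ (inj₁ refl)) (inj₁ refl) = x≁y ∘ sym G
    nonadjacent x≁y (inj₂ (inj₁ refl)) (inj₂ (inj₁ refl)) = irrefl G
    nonadjacent x≁y (inj₂ (inj₁ refl)) (inj₂ (inj₂ refl)) = y≁z
    nonadjacent x≁y (inj₂ (inj₂ refl)) (inj₁ refl) = x≁z ∘ sym G
    nonadjacent x≁y (inj₂ (inj₂ refl)) (inj₂ (inj₁ refl)) = y≁z ∘ sym G
    nonadjacent x≁y (inj₂ (inj₂ refl)) (inj₂ (inj₂ refl)) = irrefl G

module CutStructure (G : Graph n) (α≤2 : ∀ I → IsIndependent G I → ∣ I ∣ ≤ 2) (S : Subset n) {u v : Fin n}
                    (u∉S : u ∉ S) (v∉S : v ∉ S) (u↛v : ¬ WalkAvoiding G S u v) where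

  A B : Subset n
  A = fromDec (λ x → ¬? (x ∈? S) ×-dec ((x ≟ u) ⊎-dec dec G u x))
  B = ∁ (A ∪ S)

  ∈A⁻ : x ∈ A → x ∉ S × (x ≡ u ⊎ Adj G u x)
  ∈A⁻ = ∈fromDec⁻ _

  ∈A⁺ : x ∉ S × (x ≡ u ⊎ Adj G u x) → x ∈ A
  ∈A⁺ = ∈fromDec⁺ _

  ∈B⁻ : x ∈ B → x ∉ S × x ≢ u × ¬ Adj G u x
  ∈B⁻ x∈B = x∉S , (λ x≡u → x∉A (∈A⁺ (x∉S , inj₁ x≡u))) , (λ u~x → x∉A (∈A⁺ (x∉S , inj₂ u~x)))
    where
    x∉A∪S = x∈∁p⇒x∉p x∈B
    x∉S = x∉A∪S ∘ q⊆p∪q A S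
    x∉A = x∉A∪S ∘ p⊆p∪q S

  u≢v : u ≢ v
  u≢v refl = u↛v (here u∉S)

  u≁v : ¬ Adj G u v
  u≁v u~v = u↛v (step u∉S u~v (here v∉S))

  walk-from-A : x ∈ A → WalkAvoiding G S x v → WalkAvoiding G S u v
  walk-from-A x∈A walk with ∈A⁻ x∈A
  ... | _ , inj₁ refl = walk
  ... | _ , inj₂ u~x = step u∉S u~x walk

  A↛v : x ∈ A → ¬ Adj G x v
  A↛v x∈A x~v = u↛v (walk-from-A x∈A (step (proj₁ (∈A⁻ x∈A)) x~v (here v∉S)))

  v∉A : v ∉ A
  v∉A v∈A = u↛v (walk-from-A v∈A (here v∉S))

  walk-from-B : x ∈ B → WalkAvoiding G S x v
  walk-from-B {x} x∈B with x ≟ v | ∈B⁻ x∈B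
  ... | yes refl | _ = here v∉S
  ... | no x≢v | x∉S , x≢u , u≁x =
    step x∉S (common-nonNeighbour⇒adjacent G α≤2 x≢v (x≢u ∘ ≡-sym) u≢v (u≁x ∘ sym G) (u≁v ∘ sym G)) (here v∉S)

  A-clique : IsClique G A
  A-clique x∈A y∈A x≢y =
    common-nonNeighbour⇒adjacent G α≤2 x≢y (λ { refl → v∉A x∈A }) (λ { refl → v∉A y∈A }) (A↛v x∈A) (A↛v y∈A)

  B-clique : IsClique G B
  B-clique x∈B y∈B x≢y with ∈B⁻ x∈B | ∈B⁻ y∈B
  ... | _ , x≢u , u≁x | _ , y≢u , u≁y =
    common-nonNeighbour⇒adjacent G α≤2 x≢y (x≢u ∘ ≡-sym) (y≢u ∘ ≡-sym) (u≁x ∘ sym G) (u≁y ∘ sym G)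

  A-B-nonadjacent : x ∈ A → y ∈ B → ¬ Adj G x y
  A-B-nonadjacent x∈A y∈B x~y = u↛v (walk-from-A x∈A (step (proj₁ (∈A⁻ x∈A)) x~y (walk-from-B y∈B)))

  sides-cover : ∀ x → x ∈ A ∪ S ⊎ x ∈ B ∪ S
  sides-cover x with x ∈? A ∪ S
  ... | yes x∈A∪S = inj₁ x∈A∪S
  ... | no x∉A∪S = inj₂ (p⊆p∪q S (x∉p⇒x∈∁p x∉A∪S))

  sides-separated : x ∈ A ∪ S → y ∈ B ∪ S → Adj G x y → x ∈ B ∪ S ⊎ y ∈ A ∪ S
  sides-separated x∈ y∈ x~y with x∈p∪q⁻ A S x∈ | x∈p∪q⁻ B S y∈
  ... | inj₂ x∈S | _ = inj₁ (q⊆p∪q B S x∈S)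
  ... | inj₁ _ | inj₂ y∈S = inj₂ (q⊆p∪q A S y∈S)
  ... | inj₁ x∈A | inj₁ y∈B = contradiction x~y (A-B-nonadjacent x∈A y∈B)

  sides-meet-in-S : (A ∪ S) ∩ (B ∪ S) ⊆ S
  sides-meet-in-S x∈ with x∈p∩q⁻ (A ∪ S) (B ∪ S) x∈
  ... | x∈A∪S , x∈B∪S = [ (λ x∈B → contradiction x∈A∪S (x∈∁p⇒x∉p x∈B)) , id ]′ (x∈p∪q⁻ B S x∈B∪S)

  u∈A∪S : u ∈ A ∪ S
  u∈A∪S = p⊆p∪q S (∈A⁺ (u∉S , inj₁ refl))

  v∈B∪S : v ∈ B ∪ S
  v∈B∪S = p⊆p∪q S (x∉p⇒x∈∁p ([ v∉A , v∉S ]′ ∘ x∈p∪q⁻ A S))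

lemma3p7 : (n : ℕ) (G : Graph n) (k : ℕ) →
    Connected G → ChromaticNumber G k → IndependenceNumber G 2 →
    (S : Subset n) → ∣ S ∣ ≤ 2 → IsCutSet G S → IsClique G S →
    CliqueNumber G k
lemma3p7 n G k _ χ (_ , α≤2) S ∣S∣≤2 (u , v , u∉S , v∉S , u↛v) S-clique =
  let open CutStructure G α≤2 S u∉S v∉S u↛v
      K , K-clique , K-colouring =
        clique-cutset-colouring G sides-cover sides-separated
          (λ x∈ y∈ → S-clique (sides-meet-in-S x∈) (sides-meet-in-S y∈)) u∈A∪S v∈B∪S
          (clique∪small-colouring G A-clique S-clique ∣S∣≤2) (clique∪small-colouring G B-clique S-clique ∣S∣≤2)
  in cliqueNumber-of-colouring G χ K-clique K-colouring
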